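{- Let $G$ be a graph, $D$ a demand configuration on $G$, and $B$ a configuration on $G$ that is solvable for $D$. Suppose $v\in V(G)$ has degree $1$ and is adjacent to $v'$. Let $H$ be the subgraph of $G$ induced by removing $v$, and let $D'$ be the restriction of $D$ to $V(H)$. Define a configuration $C$ on $H$ by $C(w)=B(w)$ for all $w\ne v'$ in $H$, and $C(v')=B(v')+\left\lfloor \frac{B(v)-D(v)}{2}\right\rfloor$ if $B(v)-D(v)\ge 0$, and $C(v')=B(v')+2(B(v)-D(v))$ otherwise. Then $C$ is solvable for $D'$ on $H$.
   Context: All graphs are finite and simple. Configurations and demand configurations are integer-valued functions on the vertex set. For a graph with vertices $v_1,\dots,v_r$, a configuration $C$ is solvable for $D$ if there exist integers $n_{ij}\ge 0$ ($1\le i,j\le r$), with $n_{ij}=0$ whenever $\{v_i,v_j\}$ is not an edge, such that for every $k$, $C(v_k)+\sum_{l=1}^r n_{lk}-2\sum_{l=1}^r n_{kl}\ge D(v_k)$ (here $n_{ij}$ counts pebbling moves from $v_i$ to $v_j$, each removing two pebbles from $v_i$ and adding one to $v_j$). For non-negative configurations and demands this agrees with solvability by a sequence of legal pebbling moves. -}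

module Defs where

open import Data.Nat as ℕ using (ℕ; zero; suc)
open import Data.Nat.DivMod as ℕD using ()
open import Data.Integer using (ℤ; +_; -[1+_]; _+_; _-_; _*_; _≤_)
open import Data.Fin using (Fin; zero; suc; punchIn; punchOut)
open import Data.Bool using (Bool; true; false)
open import Data.Product using (Σ; _×_)
open import Relation.Binary.PropositionalEquality using (_≡_; _≢_; refl; sym; trans)
open import Relation.Nullary using (¬_; yes; no)
open import Data.Fin using (_≟_)

record Graph (n : ℕ) : Set where
  field
    adj    : Fin n → Fin n → Bool
    adj-sym    : ∀ i j → adj i j ≡ adj j i
    adj-irrefl : ∀ i → adj i i ≡ false
open Graph public

Config : ℕ → Set
Config n = Fin n → ℤ

sumFin : (n : ℕ) → (Fin n → ℤ) → ℤ
sumFin zero    f = + 0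
sumFin (suc n) f = f zero + sumFin n (λ i → f (suc i))

countFin : (n : ℕ) → (Fin n → Bool) → ℕ
countFin zero    p = 0
countFin (suc n) p with p zero
... | true  = suc (countFin n (λ i → p (suc i)))
... | false = countFin n (λ i → p (suc i))

degree : ∀ {n} → Graph n → Fin n → ℕ
degree {n} G v = countFin n (adj G v)

Solvable : ∀ {r} → Graph r → Config r → Config r → Set
Solvable {r} G C D =
  Σ (Fin r → Fin r → ℕ) λ m →
    (∀ i j → adj G i j ≡ false → m i j ≡ 0) ×
    (∀ k → D k ≤ (C k + sumFin r (λ l → + m l k)) - (+ 2 * sumFin r (λ l → + m k l)))

-- Subgraph induced by removing vertex v (vertices of H = Fin n,
-- identified with V(G) ∖ {v} via punchIn v).
deleteVertex : ∀ {n} → Graph (suc n) → Fin (suc n) → Graph n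
deleteVertex G v = record
  { adj    = λ i j → adj G (punchIn v i) (punchIn v j)
  ; adj-sym    = λ i j → adj-sym G (punchIn v i) (punchIn v j)
  ; adj-irrefl = λ i → adj-irrefl G (punchIn v i) }

restrict : ∀ {n} → Fin (suc n) → Config (suc n) → Config n
restrict v D i = D (punchIn v i)

adj⇒≢ : ∀ {n} (G : Graph n) {v v' : Fin n} → adj G v v' ≡ true → v ≢ v'
adj⇒≢ G {v} e refl with trans (sym e) (adj-irrefl G v)
... | ()

newValue : ℤ → ℤ → ℤ
newValue bv' (+ k)     = bv' + + (k ℕ./ 2)
newValue bv' -[1+ k ]  = bv' + + 2 * -[1+ k ]

leafConfig : ∀ {n} (G : Graph (suc n)) (B D : Config (suc n))
             (v v' : Fin (suc n)) → adj G v v' ≡ true → Config n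
leafConfig G B D v v' e w with w ≟ punchOut (adj⇒≢ G e)
... | yes _ = newValue (B v') (B v - D v)
... | no  _ = B (punchIn v w)

-- Take move counts m witnessing that B is solvable for D on G and keep only the moves
-- inside H = G − v.  A vertex other than v' exchanges nothing with v, so its balance is
-- unchanged.  The leaf v only trades with v': with a moves v → v' and b moves v' → v,
-- the balance at v gives 2a − b ≤ B(v) − D(v), and deleting these moves costs v' exactly
-- a − 2b pebbles.  The bound 2a − b ≤ x forces a − 2b ≤ ⌊x/2⌋ and a − 2b ≤ 2x, so the
-- extra pebbles placed on v' by C pay for them.
module Submission where

open import Defs
open import Data.Nat using (ℕ; suc)
open import Data.Fin using (Fin)
open import Data.Bool using (true)
open import Relation.Binary.PropositionalEquality using (_≡_)

import Data.Nat as ℕ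
open import Data.Nat.Properties using (suc-injective)
open import Data.Nat.DivMod using (_/_; m*n/n≡m; /-monoˡ-≤)
open import Data.Integer using (ℤ; +_; -[1+_]; 0ℤ; _+_; _-_; _*_; _≤_; -≤+; +≤+)
open import Data.Integer.Properties
  using (≤-trans; ≤-reflexive; +-monoˡ-≤; +-monoʳ-≤; *-monoˡ-≤-nonNeg; +-identityˡ; +-identityʳ;
         i≤i+j; i≤j⇒0≤j-i; 0≤i-j⇒j≤i; drop‿+≤+; pos-*; module ≤-Reasoning)
open import Data.Integer.Tactic.RingSolver using (solve-∀)
open import Data.Fin using (zero; suc; punchIn; punchOut; _≟_)
open import Data.Fin.Properties using (punchInᵢ≢i; punchIn-punchOut; punchIn-injective)
open import Data.Bool using (Bool; false)
open import Data.Product using (_,_)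
open import Data.Empty using (⊥-elim)
open import Function using (_∘_)
open import Relation.Nullary using (yes; no)
open import Relation.Binary.PropositionalEquality using (refl; sym; trans; cong; cong₂; subst; _≢_; module ≡-Reasoning)

countFin≢0 : ∀ n (p : Fin n → Bool) {j} → p j ≡ true → countFin n p ≢ 0
countFin≢0 (suc n) p {zero}  pj with p zero
... | true = λ ()
countFin≢0 (suc n) p {suc j} pj with p zero
... | true  = λ ()
... | false = countFin≢0 n (p ∘ suc) pj

countFin≡1⇒unique : ∀ n (p : Fin n → Bool) {i j} →
  countFin n p ≡ 1 → p i ≡ true → p j ≡ true → i ≡ j
countFin≡1⇒unique (suc n) p {zero}  {zero}  _ _ _ = refl
countFin≡1⇒unique (suc n) p {zero}  {suc j} c pi pj with p zero
... | true = ⊥-elim (countFin≢0 n (p ∘ suc) pj (suc-injective c))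
countFin≡1⇒unique (suc n) p {suc i} {zero}  c pi pj with p zero
... | true = ⊥-elim (countFin≢0 n (p ∘ suc) pi (suc-injective c))
countFin≡1⇒unique (suc n) p {suc i} {suc j} c pi pj with p zero
... | true  = ⊥-elim (countFin≢0 n (p ∘ suc) pi (suc-injective c))
... | false = cong suc (countFin≡1⇒unique n (p ∘ suc) c pi pj)

degree≡1⇒¬adj : ∀ {n} (G : Graph n) {v v' w} →
  degree G v ≡ 1 → adj G v v' ≡ true → w ≢ v' → adj G v w ≡ false
degree≡1⇒¬adj {n} G {v} {v'} {w} deg e w≢v' with adj G v w in vw
... | true  = ⊥-elim (w≢v' (countFin≡1⇒unique n (adj G v) deg vw e))
... | false = refl

punchIn≢ : ∀ {n} {i j : Fin (suc n)} (i≢j : i ≢ j) {k} → k ≢ punchOut i≢j → punchIn i k ≢ j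
punchIn≢ {i = i} i≢j {k} k≢ iₖ≡j = k≢ (punchIn-injective i k _ (trans iₖ≡j (sym (punchIn-punchOut i≢j))))

swapˡ : ∀ (x y z : ℤ) → x + (y + z) ≡ y + (x + z)
swapˡ = solve-∀

sumFin-punchIn : ∀ n (f : Fin (suc n) → ℤ) v → sumFin (suc n) f ≡ f v + sumFin n (f ∘ punchIn v)
sumFin-punchIn n       f zero    = refl
sumFin-punchIn (suc n) f (suc v) =
  trans (cong (_+_ (f zero)) (sumFin-punchIn n (f ∘ suc) v))
        (swapˡ (f zero) (f (suc v)) (sumFin n (f ∘ suc ∘ punchIn v)))

sumFin-zero : ∀ n (f : Fin n → ℤ) → (∀ i → f i ≡ 0ℤ) → sumFin n f ≡ 0ℤ
sumFin-zero ℕ.zero  f f≡0 = refl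
sumFin-zero (suc n) f f≡0 =
  trans (cong (_+ sumFin n (f ∘ suc)) (f≡0 zero))
        (trans (+-identityˡ _) (sumFin-zero n (f ∘ suc) (f≡0 ∘ suc)))

sumFin-supported : ∀ n (f : Fin (suc n) → ℤ) j → (∀ i → i ≢ j → f i ≡ 0ℤ) → sumFin (suc n) f ≡ f j
sumFin-supported n f j f≡0 = begin
  sumFin (suc n) f                 ≡⟨ sumFin-punchIn n f j ⟩
  f j + sumFin n (f ∘ punchIn j)   ≡⟨ cong (_+_ (f j)) (sumFin-zero n _ (λ i → f≡0 _ (punchInᵢ≢i j i))) ⟩
  f j + 0ℤ                         ≡⟨ +-identityʳ (f j) ⟩
  f j                              ∎
  where open ≡-Reasoning

≤-/2 : ∀ y k → y * + 2 ≤ + k → y ≤ + (k / 2)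
≤-/2 -[1+ _ ] k _ = -≤+
≤-/2 (+ j)    k h = +≤+ (subst (ℕ._≤ k / 2) (m*n/n≡m j 2) (/-monoˡ-≤ 2 j*2≤k))
  where j*2≤k = drop‿+≤+ (subst (_≤ + k) (sym (pos-* j 2)) h)

newValue-lower : ∀ c (a b : ℕ) x → + 2 * + a - + b ≤ x → c + (+ a - + 2 * + b) ≤ newValue c x
newValue-lower c a b (+ k)    h = +-monoʳ-≤ c (≤-/2 _ k (≤-trans doubled≤ h))
  where
  expand : ∀ a b → + 2 * a - b ≡ (a - + 2 * b) * + 2 + (b + b + b)
  expand = solve-∀
  doubled≤ : (+ a - + 2 * + b) * + 2 ≤ + 2 * + a - + b
  doubled≤ = ≤-trans (i≤i+j _ (+ b + + b + + b)) (≤-reflexive (sym (expand (+ a) (+ b))))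
newValue-lower c a b -[1+ k ] h = +-monoʳ-≤ c (≤-trans ≤doubled (*-monoˡ-≤-nonNeg (+ 2) h))
  where
  expand : ∀ a b → + 2 * (+ 2 * a - b) ≡ (a - + 2 * b) + (a + a + a)
  expand = solve-∀
  ≤doubled : + a - + 2 * + b ≤ + 2 * (+ 2 * + a - + b)
  ≤doubled = ≤-trans (i≤i+j _ (+ a + + a + + a)) (≤-reflexive (sym (expand (+ a) (+ b))))

d≤c+b-a⇒a-b≤c-d : ∀ a b c d → d ≤ (c + b) - a → a - b ≤ c - d
d≤c+b-a⇒a-b≤c-d a b c d h =
  0≤i-j⇒j≤i (subst (0ℤ ≤_) (regroup a b c d) (i≤j⇒0≤j-i h))
  where
  regroup : ∀ a b c d → ((c + b) - a) - d ≡ (c - d) - (a - b)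
  regroup = solve-∀

Moves : ℕ → Set
Moves r = Fin r → Fin r → ℕ

inflow : ∀ {r} → Moves r → Fin r → ℤ
inflow {r} m k = sumFin r (λ l → + m l k)

outflow : ∀ {r} → Moves r → Fin r → ℤ
outflow {r} m k = sumFin r (λ l → + m k l)

balance : ∀ {r} → ℤ → Moves r → Fin r → ℤ
balance c m k = (c + inflow m k) - + 2 * outflow m k

exchange : ∀ {r} → Moves r → Fin r → Fin r → ℤ
exchange m v w = + m v w - + 2 * + m w v

deleteMoves : ∀ {n} → Fin (suc n) → Moves (suc n) → Moves n
deleteMoves v m i j = m (punchIn v i) (punchIn v j)

balance-monoˡ-≤ : ∀ {r} (m : Moves r) k {c c'} → c ≤ c' → balance c m k ≤ balance c' m k
balance-monoˡ-≤ m k c≤c' = +-monoˡ-≤ _ (+-monoˡ-≤ (inflow m k) c≤c')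

balance-punchIn : ∀ {n} c (m : Moves (suc n)) v k →
  balance c m (punchIn v k) ≡ balance (c + exchange m v (punchIn v k)) (deleteMoves v m) k
balance-punchIn {n} c m v k = begin
  (c + inflow m K) - + 2 * outflow m K
    ≡⟨ cong₂ (λ i o → (c + i) - + 2 * o) (sumFin-punchIn n (λ l → + m l K) v) (sumFin-punchIn n (λ l → + m K l) v) ⟩
  (c + (+ m v K + inflow m' k)) - + 2 * (+ m K v + outflow m' k)
    ≡⟨ regroup c (+ m v K) (+ m K v) (inflow m' k) (outflow m' k) ⟩
  ((c + exchange m v K) + inflow m' k) - + 2 * outflow m' k ∎
  where
  open ≡-Reasoning
  K = punchIn v k
  m' = deleteMoves v m
  regroup : ∀ c a b i o → (c + (a + i)) - + 2 * (b + o) ≡ ((c + (a - + 2 * b)) + i) - + 2 * o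
  regroup = solve-∀

balance-leaf : ∀ {n} c (m : Moves (suc n)) {v v'} →
  (∀ w → w ≢ v' → m w v ≡ 0) → (∀ w → w ≢ v' → m v w ≡ 0) →
  balance c m v ≡ (c + + m v' v) - + 2 * + m v v'
balance-leaf {n} c m {v} {v'} in≡0 out≡0 = cong₂ (λ i o → (c + i) - + 2 * o)
  (sumFin-supported n (λ w → + m w v) v' (λ w w≢v' → cong +_ (in≡0 w w≢v')))
  (sumFin-supported n (λ w → + m v w) v' (λ w w≢v' → cong +_ (out≡0 w w≢v')))

exchange-absent : ∀ {r} (m : Moves r) {v w} → m v w ≡ 0 → m w v ≡ 0 → exchange m v w ≡ 0ℤ
exchange-absent m v→w≡0 w→v≡0 = cong₂ (λ o i → + o - + 2 * + i) v→w≡0 w→v≡0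

deleteMoves-balance : ∀ {n} (B D : Config (suc n)) (m : Moves (suc n)) v →
  (∀ K → D K ≤ balance (B K) m K) →
  ∀ k → D (punchIn v k) ≤ balance (B (punchIn v k) + exchange m v (punchIn v k)) (deleteMoves v m) k
deleteMoves-balance B D m v m-ok k =
  subst (D (punchIn v k) ≤_) (balance-punchIn (B (punchIn v k)) m v k) (m-ok (punchIn v k))

corollary6 : (n : ℕ) (G : Graph (suc n)) (B D : Config (suc n)) →
    Solvable G B D →
    (v v' : Fin (suc n)) → degree G v ≡ 1 → (e : adj G v v' ≡ true) →
    Solvable (deleteVertex G v) (leafConfig G B D v v' e) (restrict v D)
corollary6 n G B D (m , m-edge , m-ok) v v' deg e =
  deleteMoves v m , (λ i j → m-edge (punchIn v i) (punchIn v j)) , ok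
  where
  v≢v' = adj⇒≢ G e

  out≡0 : ∀ w → w ≢ v' → m v w ≡ 0
  out≡0 w w≢v' = m-edge v w (degree≡1⇒¬adj G deg e w≢v')
  in≡0 : ∀ w → w ≢ v' → m w v ≡ 0
  in≡0 w w≢v' = m-edge w v (trans (adj-sym G w v) (degree≡1⇒¬adj G deg e w≢v'))

  surplus : + 2 * + m v v' - + m v' v ≤ B v - D v
  surplus = d≤c+b-a⇒a-b≤c-d (+ 2 * + m v v') (+ m v' v) (B v) (D v)
    (subst (D v ≤_) (balance-leaf (B v) m in≡0 out≡0) (m-ok v))

  ok : ∀ k → D (punchIn v k) ≤ balance (leafConfig G B D v v' e k) (deleteMoves v m) k
  ok k with k ≟ punchOut v≢v' | deleteMoves-balance B D m v m-ok k
  ... | yes k≡ | kept = ≤-trans kept (balance-monoˡ-≤ (deleteMoves v m) k (begin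
        B (punchIn v k) + exchange m v (punchIn v k)
          ≡⟨ cong (λ w → B w + exchange m v w) (trans (cong (punchIn v) k≡) (punchIn-punchOut v≢v')) ⟩
        B v' + exchange m v v'
          ≤⟨ newValue-lower (B v') (m v v') (m v' v) (B v - D v) surplus ⟩
        newValue (B v') (B v - D v) ∎))
    where open ≤-Reasoning
  ... | no k≢ | kept = subst (λ c → D K ≤ balance c (deleteMoves v m) k)
        (trans (cong (_+_ (B K)) (exchange-absent m (out≡0 K K≢v') (in≡0 K K≢v'))) (+-identityʳ (B K))) kept
    where
    K = punchIn v k
    K≢v' = punchIn≢ v≢v' k≢
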